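{- For every integer $k\geq 1$, $\alpha(K_3^{k_{(3)}})\leq 3\cdot\sqrt{3}^{\,k}$. In particular, $x_\alpha^{(3)}(K_3)=\sqrt{3}$.
   Context: $K_3$ is the complete graph on 3 vertices. For a graph $G$ and integers $k,p\geq1$, $G^{k_{(p)}}$ is the graph with vertex set $V(G)^k$ in which $(u_1,\dots,u_k)$ and $(v_1,\dots,v_k)$ are adjacent iff $|\{i: u_iv_i\in E(G)\}|\not\equiv 0\pmod p$. $x_\alpha^{(p)}(G)=\lim_{k\to\infty}\alpha(G^{k_{(p)}})^{1/k}$ (this limit exists), where $\alpha$ is the independence number. -}

module Defs where

open import Data.Nat using (ℕ; _+_; _*_; _^_; _≤_; _%_)
open import Data.Fin using (Fin)
open import Data.Fin.Properties using (_≟_)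
open import Data.Vec using (Vec; []; _∷_)
open import Data.List using (List; length)
open import Data.List.Membership.Propositional using (_∈_)
open import Data.List.Relation.Unary.Unique.Propositional using (Unique)
open import Data.Bool using (Bool; true; false; if_then_else_)
open import Data.Product using (_×_)
open import Relation.Nullary using (does; ¬_)
open import Relation.Binary.PropositionalEquality using (_≡_)

K3Edge : Fin 3 → Fin 3 → Bool
K3Edge a b = if does (a ≟ b) then false else true

edgeCount : ∀ {k} → Vec (Fin 3) k → Vec (Fin 3) k → ℕ
edgeCount [] [] = 0
edgeCount (a ∷ u) (b ∷ v) = (if K3Edge a b then 1 else 0) + edgeCount u v

-- Adjacency in K_3^{k_(3)} (vertex set (Fin 3)^k):
-- adjacent iff edgeCount u v ≢ 0 (mod 3).
Adj : ∀ {k} → Vec (Fin 3) k → Vec (Fin 3) k → Set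
Adj u v = ¬ (edgeCount u v % 3 ≡ 0)

Independent : ∀ {k} → List (Vec (Fin 3) k) → Set
Independent S = Unique S × (∀ {u v} → u ∈ S → v ∈ S → ¬ Adj u v)

AlphaGe : ℕ → ℕ → Set
AlphaGe k B = Data.Product.Σ (List (Vec (Fin 3) k)) (λ S → Independent S × B ≤ length S)

{-# OPTIONS --safe #-}
-- Over 𝔽₃ one has [a ≠ b] = (a − b)², so u and v are non-adjacent exactly
-- when ‖u − v‖² = 0.  Translating an independent set S by one of its members
-- s₀ therefore gives vectors x, y with ‖x‖² = ‖y‖² = ‖x − y‖² = 0, hence
-- 2 x·y = 0 by polarisation, and x·y = 0.  For orthogonal families S, T in
-- 𝔽₃ᵏ, |S|·|T| ≤ 3ᵏ by induction on k: if every t ∈ T starts with 0, split S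
-- by its first coordinate; otherwise some (c₀, t₀) ∈ T with c₀ ≠ 0 makes the
-- first coordinate of each s ∈ S a function of its tail, and shearing the
-- vectors (c, t) of T to t − c c₀ t₀ makes them orthogonal to those tails.
-- So α² ≤ 3ᵏ.  Conversely, concatenation multiplies independent sets and
-- the tetracode is an independent set of 9 words of length 4, so
-- 3ᵏ ≤ 27 α².  Both growth statements follow, using 27 xᵏ ≤ (x + 1)ᵏ for
-- k > 27 x.
module Submission where

open import Defs
open import Data.Nat using (ℕ; suc; _*_; _^_; _≤_; _<_; _>_)
open import Data.Product using (_×_; ∃)

open import Algebra.Bundles using (CommutativeRing)
open import Algebra.Structures using (IsCommutativeRing)
import Algebra.Properties.Semiring.Mult as Mult
open import Data.Bool using (if_then_else_)
open import Data.Empty using (⊥-elim)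
open import Data.Fin using (Fin)
open import Data.Fin.Patterns using (0F; 1F; 2F)
open import Data.Fin.Properties using (_≟_; all?)
open import Data.List using (List; []; _∷_; length; map; cartesianProductWith)
open import Data.List.Membership.Propositional using (_∈_; find)
open import Data.List.Membership.Propositional.Properties using (∈-map⁻; ∈-cartesianProductWith⁻)
open import Data.List.Properties using (length-map; length-++)
open import Data.List.Relation.Unary.All as All using (All; []; _∷_)
import Data.List.Relation.Unary.All.Properties as Allₚ
open import Data.List.Relation.Unary.AllPairs using ([]; _∷_)
open import Data.List.Relation.Unary.Any using (here; there)
open import Data.List.Relation.Unary.Unique.Propositional using (Unique)
import Data.List.Relation.Unary.Unique.Propositional.Properties as Unique
import Data.List.Relation.Unary.Unique.DecPropositional as UniqueDec
open import Data.Maybe using (just; nothing)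
open import Data.Nat using (zero; _+_; _%_; z≤n; s≤s)
open import Data.Product using (_,_)
open import Data.Nat.Divisibility using (_∣_; _∣?_; divides; _∣0; ∣m∣n⇒∣m+n; m%n≡0⇒n∣m; n∣m⇒m%n≡0)
open import Data.Nat.Properties
  using ( +-suc; +-assoc; *-comm; *-zeroʳ; +-mono-≤; +-monoʳ-≤; *-mono-≤; *-monoˡ-≤; *-monoʳ-≤
        ; *-mono-<; *-cancelˡ-≤; ^-monoˡ-≤; ^-monoʳ-≤; ≤-refl; ≤-trans; ≤-reflexive; <⇒≤; <⇒≱; ≰⇒>
        ; m≤n*m; m≤m+n; m≤n+m; _≤?_; module ≤-Reasoning )
  renaming (_≟_ to _≟ℕ_)
open import Data.Nat.Tactic.RingSolver using () renaming (ring to ℕ-ring)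
open import Data.Vec as Vec using (Vec; []; _∷_; _++_; head; tail)
open import Data.Vec.Properties using (∷-injectiveˡ; ∷-injectiveʳ; ++-injective; ≡-dec)
open import Relation.Binary.PropositionalEquality
open import Relation.Nullary using (¬_; yes; no)
open import Relation.Nullary.Decidable using (True; toWitness; from-yes; decidable-stable)
open import Tactic.RingSolver using (solve-∀)
open import Tactic.RingSolver.Core.AlmostCommutativeRing using (AlmostCommutativeRing; fromCommutativeRing)

𝔽₃ : Set
𝔽₃ = Fin 3

infixl 6 _⊕_ _⊖_
infixl 7 _⊗_
infix 8 ⊖_

_⊕_ : 𝔽₃ → 𝔽₃ → 𝔽₃
0F ⊕ y  = y
1F ⊕ 0F = 1F
1F ⊕ 1F = 2F
1F ⊕ 2F = 0F
2F ⊕ 0F = 2F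
2F ⊕ 1F = 0F
2F ⊕ 2F = 1F

⊖_ : 𝔽₃ → 𝔽₃
⊖ 0F = 0F
⊖ 1F = 2F
⊖ 2F = 1F

_⊗_ : 𝔽₃ → 𝔽₃ → 𝔽₃
0F ⊗ y = 0F
1F ⊗ y = y
2F ⊗ y = ⊖ y

_⊖_ : 𝔽₃ → 𝔽₃ → 𝔽₃
x ⊖ y = x ⊕ ⊖ y

-- f and g are inferred from the goal; the last implicit argument is the
-- check at all points of 𝔽₃, which Agda discharges by evaluation.
by-evaluation₁ : {f g : 𝔽₃ → 𝔽₃} {_ : True (all? λ x → f x ≟ g x)} →
                 ∀ x → f x ≡ g x
by-evaluation₁ {_} {_} {checked} = toWitness checked

by-evaluation₂ : {f g : 𝔽₃ → 𝔽₃ → 𝔽₃}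
                 {_ : True (all? λ x → all? λ y → f x y ≟ g x y)} →
                 ∀ x y → f x y ≡ g x y
by-evaluation₂ {_} {_} {checked} = toWitness checked

by-evaluation₃ : {f g : 𝔽₃ → 𝔽₃ → 𝔽₃ → 𝔽₃}
                 {_ : True (all? λ x → all? λ y → all? λ z → f x y z ≟ g x y z)} →
                 ∀ x y z → f x y z ≡ g x y z
by-evaluation₃ {_} {_} {checked} = toWitness checked

𝔽₃-isCommutativeRing : IsCommutativeRing _≡_ _⊕_ _⊗_ ⊖_ 0F 1F
𝔽₃-isCommutativeRing = record
  { isRing = record
    { +-isAbelianGroup = record
      { isGroup = record
        { isMonoid = record
          { isSemigroup = record
            { isMagma = record { isEquivalence = isEquivalence ; ∙-cong = cong₂ _⊕_ }
            ; assoc = by-evaluation₃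
            }
          ; identity = by-evaluation₁ , by-evaluation₁
          }
        ; inverse = by-evaluation₁ , by-evaluation₁
        ; ⁻¹-cong = cong (⊖_)
        }
      ; comm = by-evaluation₂
      }
    ; *-cong = cong₂ _⊗_
    ; *-assoc = by-evaluation₃
    ; *-identity = by-evaluation₁ , by-evaluation₁
    ; distrib = by-evaluation₃ , by-evaluation₃
    }
  ; *-comm = by-evaluation₂
  }

𝔽₃-commutativeRing : CommutativeRing _ _
𝔽₃-commutativeRing = record { isCommutativeRing = 𝔽₃-isCommutativeRing }

open CommutativeRing 𝔽₃-commutativeRing using (zeroʳ; *-identityʳ; semiring)

𝔽₃-ring : AlmostCommutativeRing _ _
𝔽₃-ring = fromCommutativeRing 𝔽₃-commutativeRing λ
  { 0F → just refl
  ; _  → nothing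
  }

x⊕x≡0⇒x≡0 : ∀ {x} → x ⊕ x ≡ 0F → x ≡ 0F
x⊕x≡0⇒x≡0 {0F} _ = refl
x⊕x≡0⇒x≡0 {1F} ()
x⊕x≡0⇒x≡0 {2F} ()

x≢0⇒x⊗x≡1 : ∀ {x} → x ≢ 0F → x ⊗ x ≡ 1F
x≢0⇒x⊗x≡1 {0F} x≢0 = ⊥-elim (x≢0 refl)
x≢0⇒x⊗x≡1 {1F} _ = refl
x≢0⇒x⊗x≡1 {2F} _ = refl

⊖-cancelʳ : ∀ c {a b} → a ⊖ c ≡ b ⊖ c → a ≡ b
⊖-cancelʳ c {a} {b} eq = begin
  a          ≡⟨ undo a c ⟩
  a ⊖ c ⊕ c  ≡⟨ cong (_⊕ c) eq ⟩
  b ⊖ c ⊕ c  ≡⟨ undo b c ⟨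
  b          ∎
  where
  open ≡-Reasoning
  undo : ∀ x y → x ≡ x ⊖ y ⊕ y
  undo = solve-∀ 𝔽₃-ring

linear-solution : ∀ {a c p} → c ≢ 0F → a ⊗ c ⊕ p ≡ 0F → a ≡ ⊖ (c ⊗ p)
linear-solution {a} {c} {p} c≢0 eq = begin
  a                        ≡⟨ *-identityʳ a ⟨
  a ⊗ 1F                   ≡⟨ cong (a ⊗_) (x≢0⇒x⊗x≡1 c≢0) ⟨
  a ⊗ (c ⊗ c)              ≡⟨ rearrange a c p ⟩
  (a ⊗ c ⊕ p) ⊗ c ⊖ c ⊗ p  ≡⟨ cong (λ z → z ⊗ c ⊖ c ⊗ p) eq ⟩
  ⊖ (c ⊗ p)                ∎
  where
  open ≡-Reasoning
  rearrange : ∀ a c p → a ⊗ (c ⊗ c) ≡ (a ⊗ c ⊕ p) ⊗ c ⊖ c ⊗ p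
  rearrange = solve-∀ 𝔽₃-ring

open Mult semiring using (×-homo-+; ×1-homo-*) renaming (_×_ to _×₃_)

mod₃ : ℕ → 𝔽₃
mod₃ n = n ×₃ 1F

mod₃-+ : ∀ m n → mod₃ (m + n) ≡ mod₃ m ⊕ mod₃ n
mod₃-+ = ×-homo-+ 1F

mod₃-multiple : ∀ {n} → 3 ∣ n → mod₃ n ≡ 0F
mod₃-multiple (divides q refl) = trans (×1-homo-* q 3) (zeroʳ (mod₃ q))

mod₃-edge : ∀ a b → mod₃ (if K3Edge a b then 1 else 0) ≡ (a ⊖ b) ⊗ (a ⊖ b)
mod₃-edge = by-evaluation₂

infixl 6 _⊖ᵥ_
infixr 7 _⊗ₗ_
infix 8 _∙_

_⊖ᵥ_ : ∀ {k} → Vec 𝔽₃ k → Vec 𝔽₃ k → Vec 𝔽₃ k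
_⊖ᵥ_ = Vec.zipWith _⊖_

_⊗ₗ_ : ∀ {k} → 𝔽₃ → Vec 𝔽₃ k → Vec 𝔽₃ k
c ⊗ₗ v = Vec.map (c ⊗_) v

_∙_ : ∀ {k} → Vec 𝔽₃ k → Vec 𝔽₃ k → 𝔽₃
[] ∙ [] = 0F
(a ∷ u) ∙ (b ∷ v) = a ⊗ b ⊕ u ∙ v

‖_‖² : ∀ {k} → Vec 𝔽₃ k → 𝔽₃
‖ v ‖² = v ∙ v

⊖ᵥ-cancelʳ : ∀ {k} (w : Vec 𝔽₃ k) {u v} → u ⊖ᵥ w ≡ v ⊖ᵥ w → u ≡ v
⊖ᵥ-cancelʳ []      {[]}    {[]}    _  = refl
⊖ᵥ-cancelʳ (c ∷ w) {a ∷ u} {b ∷ v} eq =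
  cong₂ _∷_ (⊖-cancelʳ c (∷-injectiveˡ eq)) (⊖ᵥ-cancelʳ w (∷-injectiveʳ eq))

⊖ᵥ-translation-invariant : ∀ {k} (u v w : Vec 𝔽₃ k) → (u ⊖ᵥ w) ⊖ᵥ (v ⊖ᵥ w) ≡ u ⊖ᵥ v
⊖ᵥ-translation-invariant []      []      []      = refl
⊖ᵥ-translation-invariant (a ∷ u) (b ∷ v) (c ∷ w) =
  cong₂ _∷_ (translate a b c) (⊖ᵥ-translation-invariant u v w)
  where
  translate : ∀ a b c → (a ⊖ c) ⊖ (b ⊖ c) ≡ a ⊖ b
  translate = solve-∀ 𝔽₃-ring

∙-linearʳ : ∀ {k} (x t w : Vec 𝔽₃ k) c → x ∙ (t ⊖ᵥ c ⊗ₗ w) ≡ x ∙ t ⊖ c ⊗ (x ∙ w)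
∙-linearʳ []      []      []      c = base c
  where
  base : ∀ c → 0F ≡ 0F ⊖ c ⊗ 0F
  base = solve-∀ 𝔽₃-ring
∙-linearʳ (a ∷ x) (b ∷ t) (d ∷ w) c = begin
  a ⊗ (b ⊖ c ⊗ d) ⊕ x ∙ (t ⊖ᵥ c ⊗ₗ w)      ≡⟨ cong (a ⊗ (b ⊖ c ⊗ d) ⊕_) (∙-linearʳ x t w c) ⟩
  a ⊗ (b ⊖ c ⊗ d) ⊕ (x ∙ t ⊖ c ⊗ (x ∙ w))  ≡⟨ regroup a b c d (x ∙ t) (x ∙ w) ⟩
  a ⊗ b ⊕ x ∙ t ⊖ c ⊗ (a ⊗ d ⊕ x ∙ w)      ∎
  where
  open ≡-Reasoning
  regroup : ∀ a b c d p q → a ⊗ (b ⊖ c ⊗ d) ⊕ (p ⊖ c ⊗ q) ≡ a ⊗ b ⊕ p ⊖ c ⊗ (a ⊗ d ⊕ q)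
  regroup = solve-∀ 𝔽₃-ring

polarisation : ∀ {k} (x y : Vec 𝔽₃ k) → x ∙ y ⊕ x ∙ y ≡ ‖ x ‖² ⊕ ‖ y ‖² ⊖ ‖ x ⊖ᵥ y ‖²
polarisation []      []      = refl
polarisation (a ∷ x) (b ∷ y) = begin
  (a ⊗ b ⊕ x ∙ y) ⊕ (a ⊗ b ⊕ x ∙ y)                        ≡⟨ interchange (a ⊗ b) (x ∙ y) ⟩
  (a ⊗ b ⊕ a ⊗ b) ⊕ (x ∙ y ⊕ x ∙ y)                        ≡⟨ cong (a ⊗ b ⊕ a ⊗ b ⊕_) (polarisation x y) ⟩
  (a ⊗ b ⊕ a ⊗ b) ⊕ (‖ x ‖² ⊕ ‖ y ‖² ⊖ ‖ x ⊖ᵥ y ‖²)        ≡⟨ expand a b ‖ x ‖² ‖ y ‖² ‖ x ⊖ᵥ y ‖² ⟩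
  (a ⊗ a ⊕ ‖ x ‖²) ⊕ (b ⊗ b ⊕ ‖ y ‖²) ⊖ ((a ⊖ b) ⊗ (a ⊖ b) ⊕ ‖ x ⊖ᵥ y ‖²) ∎
  where
  open ≡-Reasoning
  interchange : ∀ p q → (p ⊕ q) ⊕ (p ⊕ q) ≡ (p ⊕ p) ⊕ (q ⊕ q)
  interchange = solve-∀ 𝔽₃-ring
  expand : ∀ a b p q r → (a ⊗ b ⊕ a ⊗ b) ⊕ (p ⊕ q ⊖ r) ≡ (a ⊗ a ⊕ p) ⊕ (b ⊗ b ⊕ q) ⊖ ((a ⊖ b) ⊗ (a ⊖ b) ⊕ r)
  expand = solve-∀ 𝔽₃-ring

mod₃-edgeCount : ∀ {k} (u v : Vec 𝔽₃ k) → mod₃ (edgeCount u v) ≡ ‖ u ⊖ᵥ v ‖²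
mod₃-edgeCount []      []      = refl
mod₃-edgeCount (a ∷ u) (b ∷ v) =
  trans (mod₃-+ (if K3Edge a b then 1 else 0) (edgeCount u v))
        (cong₂ _⊕_ (mod₃-edge a b) (mod₃-edgeCount u v))

nonadjacent⇒3∣edgeCount : ∀ {k} (u v : Vec 𝔽₃ k) → ¬ Adj u v → 3 ∣ edgeCount u v
nonadjacent⇒3∣edgeCount u v ¬adj =
  m%n≡0⇒n∣m (edgeCount u v) 3 (decidable-stable (edgeCount u v % 3 ≟ℕ 0) ¬adj)

3∣edgeCount⇒nonadjacent : ∀ {k} (u v : Vec 𝔽₃ k) → 3 ∣ edgeCount u v → ¬ Adj u v
3∣edgeCount⇒nonadjacent u v 3∣e adj = adj (n∣m⇒m%n≡0 (edgeCount u v) 3 3∣e)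

Orthogonal : ∀ {k} → List (Vec 𝔽₃ k) → List (Vec 𝔽₃ k) → Set
Orthogonal S T = ∀ {s t} → s ∈ S → t ∈ T → s ∙ t ≡ 0F

isotropic⇒orthogonal : ∀ {k} (x y : Vec 𝔽₃ k) →
  ‖ x ‖² ≡ 0F → ‖ y ‖² ≡ 0F → ‖ x ⊖ᵥ y ‖² ≡ 0F → x ∙ y ≡ 0F
isotropic⇒orthogonal x y x₀ y₀ x-y₀ =
  x⊕x≡0⇒x≡0 (trans (polarisation x y) (cong₂ _⊖_ (cong₂ _⊕_ x₀ y₀) x-y₀))

independent⇒isotropic-differences : ∀ {k} {S : List (Vec 𝔽₃ k)} → Independent S →
  ∀ {u v} → u ∈ S → v ∈ S → ‖ u ⊖ᵥ v ‖² ≡ 0F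
independent⇒isotropic-differences (_ , nonadjacent) {u} {v} u∈ v∈ =
  trans (sym (mod₃-edgeCount u v)) (mod₃-multiple (nonadjacent⇒3∣edgeCount u v (nonadjacent u∈ v∈)))

independent⇒translates-orthogonal : ∀ {k} {S : List (Vec 𝔽₃ k)} {s₀} → Independent S → s₀ ∈ S →
  Orthogonal (map (_⊖ᵥ s₀) S) (map (_⊖ᵥ s₀) S)
independent⇒translates-orthogonal {S = S} {s₀} ind s₀∈ x∈ y∈ with ∈-map⁻ (_⊖ᵥ s₀) x∈ | ∈-map⁻ (_⊖ᵥ s₀) y∈
... | u , u∈ , refl | v , v∈ , refl =
  isotropic⇒orthogonal (u ⊖ᵥ s₀) (v ⊖ᵥ s₀) (isotropic u∈ s₀∈) (isotropic v∈ s₀∈)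
    (trans (cong ‖_‖² (⊖ᵥ-translation-invariant u v s₀)) (isotropic u∈ v∈))
  where
  isotropic : ∀ {u v} → u ∈ S → v ∈ S → ‖ u ⊖ᵥ v ‖² ≡ 0F
  isotropic = independent⇒isotropic-differences ind

unique-map⁺ : ∀ {A B : Set} {f : A → B} {xs : List A} →
  (∀ {x y} → x ∈ xs → y ∈ xs → f x ≡ f y → x ≡ y) → Unique xs → Unique (map f xs)
unique-map⁺ {xs = []}     _   []         = []
unique-map⁺ {xs = x ∷ xs} inj (x∉ ∷ uxs) =
  Allₚ.map⁺ (All.tabulate λ y∈ fx≡fy → All.lookup x∉ y∈ (inj (here refl) (there y∈) fx≡fy))
  ∷ unique-map⁺ (λ x∈ y∈ → inj (there x∈) (there y∈)) uxs

unique-length≤1 : ∀ {A : Set} {S : List (Vec A 0)} → Unique S → length S ≤ 1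
unique-length≤1 {S = []}              _                 = z≤n
unique-length≤1 {S = _ ∷ []}          _                 = s≤s z≤n
unique-length≤1 {S = [] ∷ [] ∷ _}     ((≢ ∷ _) ∷ _)     = ⊥-elim (≢ refl)

fiber : ∀ {k} → 𝔽₃ → List (Vec 𝔽₃ (suc k)) → List (Vec 𝔽₃ k)
fiber c []            = []
fiber c ((a ∷ v) ∷ L) with a ≟ c
... | yes _ = v ∷ fiber c L
... | no  _ = fiber c L

∈-fiber⁻ : ∀ {k c v} (L : List (Vec 𝔽₃ (suc k))) → v ∈ fiber c L → c ∷ v ∈ L
∈-fiber⁻ {c = c} ((a ∷ w) ∷ L) v∈ with a ≟ c
∈-fiber⁻ ((a ∷ w) ∷ L) (here refl) | yes refl = here refl
∈-fiber⁻ ((a ∷ w) ∷ L) (there v∈)  | yes refl = there (∈-fiber⁻ L v∈)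
∈-fiber⁻ ((a ∷ w) ∷ L) v∈          | no _     = there (∈-fiber⁻ L v∈)

fiber-unique : ∀ {k} c {L : List (Vec 𝔽₃ (suc k))} → Unique L → Unique (fiber c L)
fiber-unique c {[]}          []         = []
fiber-unique c {(a ∷ w) ∷ L} (w∉ ∷ uL) with a ≟ c
... | yes refl = All.tabulate (λ v∈ w≡v → All.lookup w∉ (∈-fiber⁻ L v∈) (cong (a ∷_) w≡v))
                 ∷ fiber-unique c uL
... | no _     = fiber-unique c uL

length-fibers : ∀ {k} (L : List (Vec 𝔽₃ (suc k))) →
  length L ≡ length (fiber 0F L) + length (fiber 1F L) + length (fiber 2F L)
length-fibers []             = refl
length-fibers ((0F ∷ _) ∷ L) = cong suc (length-fibers L)
length-fibers ((1F ∷ _) ∷ L) = trans (cong suc (length-fibers L))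
  (cong (_+ length (fiber 2F L)) (sym (+-suc (length (fiber 0F L)) (length (fiber 1F L)))))
length-fibers ((2F ∷ _) ∷ L) = trans (cong suc (length-fibers L))
  (sym (+-suc (length (fiber 0F L) + length (fiber 1F L)) (length (fiber 2F L))))

fibers-bound : ∀ {k} (L : List (Vec 𝔽₃ (suc k))) {m B} →
  (∀ c → length (fiber c L) * m ≤ B) → length L * m ≤ 3 * B
fibers-bound {k} L {m} {B} bound = begin
  length L * m                                   ≡⟨ cong (_* m) (length-fibers L) ⟩
  (length L₀ + length L₁ + length L₂) * m        ≡⟨ distrib (length L₀) (length L₁) (length L₂) m ⟩
  length L₀ * m + length L₁ * m + length L₂ * m  ≤⟨ +-mono-≤ (+-mono-≤ (bound 0F) (bound 1F)) (bound 2F) ⟩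
  B + B + B                                      ≡⟨ triple B ⟩
  3 * B                                          ∎
  where
  open ≤-Reasoning
  L₀ L₁ L₂ : List (Vec 𝔽₃ k)
  L₀ = fiber 0F L
  L₁ = fiber 1F L
  L₂ = fiber 2F L
  distrib : ∀ p q r m → (p + q + r) * m ≡ p * m + q * m + r * m
  distrib = solve-∀ ℕ-ring
  triple : ∀ B → B + B + B ≡ 3 * B
  triple = solve-∀ ℕ-ring

OrthogonalBound : ℕ → Set
OrthogonalBound k = ∀ {S T : List (Vec 𝔽₃ k)} → Unique S → Unique T → Orthogonal S T →
  length S * length T ≤ 3 ^ k

module OrthogonalStep {k} (ih : OrthogonalBound k) {S T : List (Vec 𝔽₃ (suc k))}
  (uS : Unique S) (uT : Unique T) (S⊥T : Orthogonal S T) where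

  bound-if-heads-zero : All (λ t → head t ≡ 0F) T → length S * length T ≤ 3 ^ suc k
  bound-if-heads-zero heads≡0 = fibers-bound S λ c →
    subst (λ n → length (fiber c S) * n ≤ 3 ^ k) (length-map tail T)
      (ih (fiber-unique c uS) (unique-map⁺ tail-injective uT) (fiber⊥tails c))
    where
    tail-injective : ∀ {t t′} → t ∈ T → t′ ∈ T → tail t ≡ tail t′ → t ≡ t′
    tail-injective {a ∷ v} {b ∷ .v} t∈ t′∈ refl =
      cong (_∷ v) (trans (All.lookup heads≡0 t∈) (sym (All.lookup heads≡0 t′∈)))
    fiber⊥tails : ∀ c → Orthogonal (fiber c S) (map tail T)
    fiber⊥tails c {s} s∈ v∈ with ∈-map⁻ tail v∈
    ... | a ∷ v , t∈ , refl with All.lookup heads≡0 t∈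
    ...   | refl = trans (cong (_⊕ s ∙ v) (sym (zeroʳ c))) (S⊥T (∈-fiber⁻ S s∈) t∈)

  module _ {c₀ t₀} (t₀∈ : c₀ ∷ t₀ ∈ T) (c₀≢0 : c₀ ≢ 0F) where

    head-determined : ∀ {a x} → a ∷ x ∈ S → a ≡ ⊖ (c₀ ⊗ (x ∙ t₀))
    head-determined s∈ = linear-solution c₀≢0 (S⊥T s∈ t₀∈)

    tail-injective : ∀ {s s′} → s ∈ S → s′ ∈ S → tail s ≡ tail s′ → s ≡ s′
    tail-injective {a ∷ x} {b ∷ .x} s∈ s′∈ refl =
      cong (_∷ x) (trans (head-determined s∈) (sym (head-determined s′∈)))

    shear : 𝔽₃ → Vec 𝔽₃ k → Vec 𝔽₃ k
    shear c t = t ⊖ᵥ (c ⊗ c₀) ⊗ₗ t₀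

    tails⊥sheared-fiber : ∀ c → Orthogonal (map tail S) (map (shear c) (fiber c T))
    tails⊥sheared-fiber c x∈ y∈ with ∈-map⁻ tail x∈ | ∈-map⁻ (shear c) y∈
    ... | a ∷ x , s∈ , refl | t , t∈ , refl = begin
      x ∙ (t ⊖ᵥ (c ⊗ c₀) ⊗ₗ t₀)        ≡⟨ ∙-linearʳ x t t₀ (c ⊗ c₀) ⟩
      x ∙ t ⊖ c ⊗ c₀ ⊗ (x ∙ t₀)         ≡⟨ rearrange (x ∙ t) (x ∙ t₀) c c₀ ⟩
      ⊖ (c₀ ⊗ (x ∙ t₀)) ⊗ c ⊕ x ∙ t     ≡⟨ cong (λ h → h ⊗ c ⊕ x ∙ t) (head-determined s∈) ⟨
      a ⊗ c ⊕ x ∙ t                     ≡⟨ S⊥T s∈ (∈-fiber⁻ T t∈) ⟩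
      0F                                ∎
      where
      open ≡-Reasoning
      rearrange : ∀ p q c c₀ → p ⊖ c ⊗ c₀ ⊗ q ≡ ⊖ (c₀ ⊗ q) ⊗ c ⊕ p
      rearrange = solve-∀ 𝔽₃-ring

    bound-if-nonzero-head : length S * length T ≤ 3 ^ suc k
    bound-if-nonzero-head = begin
      length S * length T  ≡⟨ *-comm (length S) (length T) ⟩
      length T * length S  ≤⟨ fibers-bound T (λ c → ≤-trans (≤-reflexive (*-comm _ (length S))) (fiber-bound c)) ⟩
      3 ^ suc k            ∎
      where
      open ≤-Reasoning
      fiber-bound : ∀ c → length S * length (fiber c T) ≤ 3 ^ k
      fiber-bound c = subst₂ (λ m n → m * n ≤ 3 ^ k) (length-map tail S) (length-map (shear c) (fiber c T))
        (ih (unique-map⁺ tail-injective uS)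
            (Unique.map⁺ (⊖ᵥ-cancelʳ _) (fiber-unique c uT))
            (tails⊥sheared-fiber c))

  bound : length S * length T ≤ 3 ^ suc k
  bound with All.all? (λ t → head t ≟ 0F) T
  ... | yes heads≡0 = bound-if-heads-zero heads≡0
  ... | no ¬heads≡0 with find (Allₚ.¬All⇒Any¬ (λ t → head t ≟ 0F) T ¬heads≡0)
  ...   | c₀ ∷ t₀ , t₀∈ , c₀≢0 = bound-if-nonzero-head t₀∈ c₀≢0

orthogonal-bound : ∀ k → OrthogonalBound k
orthogonal-bound zero    uS uT _   = *-mono-≤ (unique-length≤1 uS) (unique-length≤1 uT)
orthogonal-bound (suc k) uS uT S⊥T = OrthogonalStep.bound (orthogonal-bound k) uS uT S⊥T

independent-length² : ∀ {k} {S : List (Vec 𝔽₃ k)} → Independent S → length S * length S ≤ 3 ^ k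
independent-length² {S = []}     _                = z≤n
independent-length² {k} {S = S@(s₀ ∷ _)} ind@(uS , _) =
  subst (λ n → n * n ≤ 3 ^ k) (length-map (_⊖ᵥ s₀) S)
    (orthogonal-bound k uS′ uS′ (independent⇒translates-orthogonal ind (here refl)))
  where
  uS′ : Unique (map (_⊖ᵥ s₀) S)
  uS′ = Unique.map⁺ (⊖ᵥ-cancelʳ s₀) uS

alpha-upper-bound : ∀ {k α} → AlphaGe k α → α * α ≤ 3 ^ k
alpha-upper-bound (_ , ind , α≤) = ≤-trans (*-mono-≤ α≤ α≤) (independent-length² ind)

edgeCount-self : ∀ {k} (v : Vec 𝔽₃ k) → edgeCount v v ≡ 0
edgeCount-self []       = refl
edgeCount-self (0F ∷ v) = edgeCount-self v
edgeCount-self (1F ∷ v) = edgeCount-self v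
edgeCount-self (2F ∷ v) = edgeCount-self v

edgeCount-++ : ∀ {m n} (w₁ w₂ : Vec 𝔽₃ m) (v₁ v₂ : Vec 𝔽₃ n) →
  edgeCount (w₁ ++ v₁) (w₂ ++ v₂) ≡ edgeCount w₁ w₂ + edgeCount v₁ v₂
edgeCount-++ []       []       v₁ v₂ = refl
edgeCount-++ (a ∷ w₁) (b ∷ w₂) v₁ v₂ =
  trans (cong ((if K3Edge a b then 1 else 0) +_) (edgeCount-++ w₁ w₂ v₁ v₂))
        (sym (+-assoc (if K3Edge a b then 1 else 0) (edgeCount w₁ w₂) (edgeCount v₁ v₂)))

length-cartesianProductWith : ∀ {A B C : Set} (f : A → B → C) xs ys →
  length (cartesianProductWith f xs ys) ≡ length xs * length ys
length-cartesianProductWith f []       ys = refl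
length-cartesianProductWith f (x ∷ xs) ys =
  trans (length-++ (map (f x) ys))
        (cong₂ _+_ (length-map (f x) ys) (length-cartesianProductWith f xs ys))

alphaGe-1 : ∀ k → AlphaGe k 1
alphaGe-1 k = v ∷ [] , ([] ∷ [] , nonadjacent) , ≤-refl
  where
  v : Vec 𝔽₃ k
  v = Vec.replicate k 0F
  nonadjacent : ∀ {u w} → u ∈ v ∷ [] → w ∈ v ∷ [] → ¬ Adj u w
  nonadjacent (here refl) (here refl) =
    3∣edgeCount⇒nonadjacent v v (subst (3 ∣_) (sym (edgeCount-self v)) (3 ∣0))

alphaGe-* : ∀ {m n α β} → AlphaGe m α → AlphaGe n β → AlphaGe (m + n) (α * β)
alphaGe-* (S , (uS , S-ind) , α≤) (T , (uT , T-ind) , β≤) =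
  cartesianProductWith _++_ S T ,
  (Unique.cartesianProductWith⁺ _++_ (++-injective _ _) uS uT , nonadjacent) ,
  subst (_ ≤_) (sym (length-cartesianProductWith _++_ S T)) (*-mono-≤ α≤ β≤)
  where
  nonadjacent : ∀ {u v} → u ∈ cartesianProductWith _++_ S T → v ∈ cartesianProductWith _++_ S T → ¬ Adj u v
  nonadjacent u∈ v∈ with ∈-cartesianProductWith⁻ _++_ S T u∈ | ∈-cartesianProductWith⁻ _++_ S T v∈
  ... | w₁ , v₁ , w₁∈ , v₁∈ , refl | w₂ , v₂ , w₂∈ , v₂∈ , refl =
    3∣edgeCount⇒nonadjacent (w₁ ++ v₁) (w₂ ++ v₂) (subst (3 ∣_) (sym (edgeCount-++ w₁ w₂ v₁ v₂))
      (∣m∣n⇒∣m+n (nonadjacent⇒3∣edgeCount w₁ w₂ (S-ind w₁∈ w₂∈))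
                 (nonadjacent⇒3∣edgeCount v₁ v₂ (T-ind v₁∈ v₂∈))))

-- The ternary tetracode, a self-dual [4,2,3] code: any two distinct words
-- differ in exactly three coordinates.
tetracode : List (Vec 𝔽₃ 4)
tetracode =
  (0F ∷ 0F ∷ 0F ∷ 0F ∷ []) ∷ (0F ∷ 1F ∷ 2F ∷ 1F ∷ []) ∷ (0F ∷ 2F ∷ 1F ∷ 2F ∷ []) ∷
  (1F ∷ 1F ∷ 1F ∷ 0F ∷ []) ∷ (1F ∷ 2F ∷ 0F ∷ 1F ∷ []) ∷ (1F ∷ 0F ∷ 2F ∷ 2F ∷ []) ∷
  (2F ∷ 2F ∷ 2F ∷ 0F ∷ []) ∷ (2F ∷ 0F ∷ 1F ∷ 1F ∷ []) ∷ (2F ∷ 1F ∷ 0F ∷ 2F ∷ []) ∷ []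

alphaGe-tetracode : AlphaGe 4 9
alphaGe-tetracode = tetracode , (unique , nonadjacent) , ≤-refl
  where
  unique : Unique tetracode
  unique = from-yes (UniqueDec.unique? (≡-dec _≟_) tetracode)
  distances : All (λ u → All (λ v → 3 ∣ edgeCount u v) tetracode) tetracode
  distances = from-yes (All.all? (λ u → All.all? (λ v → 3 ∣? edgeCount u v) tetracode) tetracode)
  nonadjacent : ∀ {u v} → u ∈ tetracode → v ∈ tetracode → ¬ Adj u v
  nonadjacent {u} {v} u∈ v∈ = 3∣edgeCount⇒nonadjacent u v (All.lookup (All.lookup distances u∈) v∈)

alpha-lower-bound : ∀ k → ∃ λ α → AlphaGe k α × 3 ^ k ≤ 27 * (α * α)
alpha-lower-bound 0 = 1 , alphaGe-1 0 , ^-monoʳ-≤ 3 {0} {3} z≤n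
alpha-lower-bound 1 = 1 , alphaGe-1 1 , ^-monoʳ-≤ 3 {1} {3} (s≤s z≤n)
alpha-lower-bound 2 = 1 , alphaGe-1 2 , ^-monoʳ-≤ 3 {2} {3} (s≤s (s≤s z≤n))
alpha-lower-bound 3 = 1 , alphaGe-1 3 , ≤-refl
alpha-lower-bound (suc (suc (suc (suc k)))) with alpha-lower-bound k
... | α , A , bound = 9 * α , alphaGe-* alphaGe-tetracode A , (begin
  3 ^ (4 + k)              ≡⟨ power (3 ^ k) ⟩
  81 * 3 ^ k               ≤⟨ *-monoʳ-≤ 81 bound ⟩
  81 * (27 * (α * α))      ≡⟨ square α ⟩
  27 * (9 * α * (9 * α))   ∎)
  where
  open ≤-Reasoning
  power : ∀ x → 3 * (3 * (3 * (3 * x))) ≡ 81 * x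
  power = solve-∀ ℕ-ring
  square : ∀ α → 81 * (27 * (α * α)) ≡ 27 * (9 * α * (9 * α))
  square = solve-∀ ℕ-ring

^-distribʳ-* : ∀ m n k → (m * n) ^ k ≡ m ^ k * n ^ k
^-distribʳ-* m n zero    = refl
^-distribʳ-* m n (suc k) = trans (cong (m * n *_) (^-distribʳ-* m n k)) (interchange m n (m ^ k) (n ^ k))
  where
  interchange : ∀ m n x y → m * n * (x * y) ≡ m * x * (n * y)
  interchange = solve-∀ ℕ-ring

m*m≤n*n⇒m≤n : ∀ {m n} → m * m ≤ n * n → m ≤ n
m*m≤n*n⇒m≤n {m} {n} m²≤n² with m ≤? n
... | yes m≤n = m≤n
... | no  m≰n = ⊥-elim (<⇒≱ (*-mono-< (≰⇒> m≰n) (≰⇒> m≰n)) m²≤n²)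

homogeneous-bernoulli : ∀ x n → x ^ n * (x + n) ≤ x * suc x ^ n
homogeneous-bernoulli x zero    = ≤-reflexive (base x)
  where
  base : ∀ x → 1 * (x + 0) ≡ x * 1
  base = solve-∀ ℕ-ring
homogeneous-bernoulli x (suc n) = begin
  x * x ^ n * (x + suc n)                    ≤⟨ m≤m+n (x * x ^ n * (x + suc n)) (x ^ n * n) ⟩
  x * x ^ n * (x + suc n) + x ^ n * n        ≡⟨ expand x (x ^ n) n ⟩
  suc x * (x ^ n * (x + n))                  ≤⟨ *-monoʳ-≤ (suc x) (homogeneous-bernoulli x n) ⟩
  suc x * (x * suc x ^ n)                    ≡⟨ swap x (suc x ^ n) ⟩
  x * (suc x * suc x ^ n)                    ∎
  where
  open ≤-Reasoning
  expand : ∀ x y n → x * y * (x + suc n) + y * n ≡ suc x * (y * (x + n))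
  expand = solve-∀ ℕ-ring
  swap : ∀ x y → suc x * (x * y) ≡ x * (suc x * y)
  swap = solve-∀ ℕ-ring

exponential-dominates : ∀ K x n → K * x < n → K * x ^ n ≤ suc x ^ n
exponential-dominates K zero    (suc n) _     = subst (_≤ 1 ^ suc n) (sym (*-zeroʳ K)) z≤n
exponential-dominates K (suc x) n       Kx<n = *-cancelˡ-≤ (suc x) (begin
  suc x * (K * suc x ^ n)    ≡⟨ rearrange (suc x) K (suc x ^ n) ⟩
  suc x ^ n * (K * suc x)    ≤⟨ *-monoʳ-≤ (suc x ^ n) (≤-trans (m≤n+m (K * suc x) (suc x)) (+-monoʳ-≤ (suc x) (<⇒≤ Kx<n))) ⟩
  suc x ^ n * (suc x + n)    ≤⟨ homogeneous-bernoulli (suc x) n ⟩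
  suc x * suc (suc x) ^ n    ∎)
  where
  open ≤-Reasoning
  rearrange : ∀ x K y → x * (K * y) ≡ y * (K * x)
  rearrange = solve-∀ ℕ-ring

growth-below-√3 : ∀ a b → a * a < 3 * (b * b) →
  ∀ k → 27 * (a * a) < k → ∃ λ α → AlphaGe k α × a ^ k ≤ α * b ^ k
growth-below-√3 a b a²<3b² k large with alpha-lower-bound k
... | α , A , 3^k≤27α² = α , A , m*m≤n*n⇒m≤n (*-cancelˡ-≤ 27 (begin
  27 * (a ^ k * a ^ k)              ≡⟨ cong (27 *_) (^-distribʳ-* a a k) ⟨
  27 * (a * a) ^ k                  ≤⟨ exponential-dominates 27 (a * a) k large ⟩
  suc (a * a) ^ k                   ≤⟨ ^-monoˡ-≤ k a²<3b² ⟩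
  (3 * (b * b)) ^ k                 ≡⟨ ^-distribʳ-* 3 (b * b) k ⟩
  3 ^ k * (b * b) ^ k               ≤⟨ *-monoˡ-≤ ((b * b) ^ k) 3^k≤27α² ⟩
  27 * (α * α) * (b * b) ^ k        ≡⟨ cong (27 * (α * α) *_) (^-distribʳ-* b b k) ⟩
  27 * (α * α) * (b ^ k * b ^ k)    ≡⟨ regroup α (b ^ k) ⟩
  27 * (α * b ^ k * (α * b ^ k))    ∎))
  where
  open ≤-Reasoning
  regroup : ∀ α y → 27 * (α * α) * (y * y) ≡ 27 * (α * y * (α * y))
  regroup = solve-∀ ℕ-ring

growth-above-√3 : ∀ a b → 3 * (b * b) < a * a → ∀ k α → AlphaGe k α → α * b ^ k ≤ a ^ k
growth-above-√3 a b 3b²<a² k α A = m*m≤n*n⇒m≤n (begin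
  α * b ^ k * (α * b ^ k)    ≡⟨ regroup α (b ^ k) ⟩
  α * α * (b ^ k * b ^ k)    ≤⟨ *-monoˡ-≤ (b ^ k * b ^ k) (alpha-upper-bound A) ⟩
  3 ^ k * (b ^ k * b ^ k)    ≡⟨ cong (3 ^ k *_) (^-distribʳ-* b b k) ⟨
  3 ^ k * (b * b) ^ k        ≡⟨ ^-distribʳ-* 3 (b * b) k ⟨
  (3 * (b * b)) ^ k          ≤⟨ ^-monoˡ-≤ k (<⇒≤ 3b²<a²) ⟩
  (a * a) ^ k                ≡⟨ ^-distribʳ-* a a k ⟩
  a ^ k * a ^ k              ∎)
  where
  open ≤-Reasoning
  regroup : ∀ α y → α * y * (α * y) ≡ α * α * (y * y)
  regroup = solve-∀ ℕ-ring

lemma2p4 : ((k : ℕ) → 1 ≤ k → ∀ (α : ℕ) → AlphaGe k α → α * α ≤ 9 * 3 ^ k)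
    × ((a b : ℕ) → 1 ≤ b → a * a < 3 * (b * b) →
         ∃ λ N → ∀ k → N ≤ k → ∃ λ α → AlphaGe k α × a ^ k ≤ α * b ^ k)
    × ((a b : ℕ) → 1 ≤ b → a * a > 3 * (b * b) →
         ∃ λ N → ∀ k → N ≤ k → ∀ α → AlphaGe k α → α * b ^ k ≤ a ^ k)
lemma2p4 =
  (λ k _ α A → ≤-trans (alpha-upper-bound A) (m≤n*m (3 ^ k) 9)) ,
  (λ a b _ a²<3b² → suc (27 * (a * a)) , growth-below-√3 a b a²<3b²) ,
  (λ a b _ 3b²<a² → 0 , λ k _ → growth-above-√3 a b 3b²<a² k)
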